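{- Let $G$ be a graph with no $K_1 \cup K_4$ minor, and let $S$ be a spanning subgraph of $G$ that is a subdivision of $K_{2,3}$ with terminal paths $P_1,P_2,P_3$, where $P_2$ is a middle path among $\{P_1,P_2,P_3\}$. Then there do not exist edges $e_1=(u_1,v_1)$ and $e_2=(u_1,v_2)$ of $G$ such that $u_1$ is an inner vertex of $P_1$ or of $P_3$ and $v_1, v_2$ are two distinct inner vertices of $P_2$.
   Context: A subdivision of a graph is obtained by repeatedly replacing an edge by a path of length 2 through a new vertex. For a subdivision $S$ of $K_{2,3}$, the terminal vertices are the two vertices $u,v$ of degree $3$ in $S$ and the terminal paths are the three $uv$-paths of $S$; $S$ is spanning if it contains all vertices of $G$. An inner vertex of a $uv$-path is a vertex other than $u,v$. Given a set $\mathcal{P}$ of paths in $G$, $P\in\mathcal{P}$ is a middle path if for every other $P'\in\mathcal{P}$ some edge of $G$ joins an inner vertex of $P$ to an inner vertex of $P'$. $\cup$ denotes disjoint union. -}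

module Defs where

open import Data.Nat using (ℕ)
open import Data.Fin using (Fin; zero; suc; _≟_)
open import Data.Bool using (Bool; true; false; not)
open import Data.List using (List; []; _∷_; head; last)
open import Data.List.Membership.Propositional using (_∈_)
open import Data.List.Relation.Unary.Unique.Propositional using (Unique)
open import Data.List.Relation.Unary.All using (All)
open import Data.Maybe using (Maybe; just; nothing)
open import Data.Product using (Σ; ∃; ∃₂; _×_; _,_)
open import Data.Sum using (_⊎_)
open import Data.Unit using (⊤)
open import Data.Empty using (⊥)
open import Relation.Binary.PropositionalEquality using (_≡_; _≢_; refl)
open import Relation.Nullary using (¬_; yes; no)
open import Relation.Nullary.Decidable using (⌊_⌋)

record Graph (n : ℕ) : Set where
  field
    adj    : Fin n → Fin n → Bool
    sym    : ∀ x y → adj x y ≡ adj y x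
    irrefl : ∀ x → adj x x ≡ false
open Graph public

Edge : ∀ {n} → Graph n → Fin n → Fin n → Set
Edge G x y = adj G x y ≡ true

ConsecutiveAdj : ∀ {n} → Graph n → List (Fin n) → Set
ConsecutiveAdj G []           = ⊤
ConsecutiveAdj G (x ∷ [])     = ⊤
ConsecutiveAdj G (x ∷ y ∷ xs) = Edge G x y × ConsecutiveAdj G (y ∷ xs)

IsWalk : ∀ {n} → Graph n → Fin n → Fin n → List (Fin n) → Set
IsWalk G x y W = ConsecutiveAdj G W × head W ≡ just x × last W ≡ just y

IsPath : ∀ {n} → Graph n → Fin n → Fin n → List (Fin n) → Set
IsPath G x y P = IsWalk G x y P × Unique P

Inner : ∀ {n} → Fin n → Fin n → List (Fin n) → Fin n → Set
Inner u v P x = x ∈ P × x ≢ u × x ≢ v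

-- H is a minor of G, witnessed by a model: disjoint nonempty connected
-- branch sets (branch x = just h means x lies in the branch set of h),
-- with an edge of G between the branch sets of adjacent vertices of H.
record MinorModel {m n : ℕ} (H : Graph m) (G : Graph n) : Set where
  field
    branch    : Fin n → Maybe (Fin m)
    nonempty  : ∀ h → ∃ λ x → branch x ≡ just h
    connected : ∀ h x y → branch x ≡ just h → branch y ≡ just h →
                ∃ λ W → IsWalk G x y W × All (λ z → branch z ≡ just h) W
    edges     : ∀ h h' → Edge H h h' →
                ∃₂ λ x y → branch x ≡ just h × branch y ≡ just h' × Edge G x y

HasMinor : ∀ {m n} → Graph m → Graph n → Set
HasMinor H G = MinorModel H G

-- K₁ ∪ K₄ on Fin 5: vertex zero is isolated, the other four form a K₄.
private
  k14adj : Fin 5 → Fin 5 → Bool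
  k14adj zero    _       = false
  k14adj (suc i) zero    = false
  k14adj (suc i) (suc j) = not ⌊ i ≟ j ⌋

  k14sym : ∀ x y → k14adj x y ≡ k14adj y x
  k14sym zero    zero    = refl
  k14sym zero    (suc j) = refl
  k14sym (suc i) zero    = refl
  k14sym (suc i) (suc j) with i ≟ j | j ≟ i
  ... | yes _ | yes _ = refl
  ... | no _  | no _  = refl
  ... | yes refl | no q = Data.Empty.⊥-elim (q refl)
    where import Data.Empty
  ... | no p  | yes refl = Data.Empty.⊥-elim (p refl)
    where import Data.Empty

  k14irr : ∀ x → k14adj x x ≡ false
  k14irr zero = refl
  k14irr (suc i) with i ≟ i
  ... | yes _ = refl
  ... | no p  = Data.Empty.⊥-elim (p refl)
    where import Data.Empty

K₁∪K₄ : Graph 5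
K₁∪K₄ = record { adj = k14adj ; sym = k14sym ; irrefl = k14irr }

-- S = P₁ ∪ P₂ ∪ P₃ is a spanning subgraph of G which is a subdivision of
-- K_{2,3} with terminal vertices u, v and terminal paths P₁, P₂, P₃:
-- three internally disjoint uv-paths of G, each with at least one inner
-- vertex, together covering all vertices of G.
record SpanningK23Subdivision {n} (G : Graph n) (u v : Fin n)
         (P₁ P₂ P₃ : List (Fin n)) : Set where
  field
    u≢v      : u ≢ v
    path₁    : IsPath G u v P₁
    path₂    : IsPath G u v P₂
    path₃    : IsPath G u v P₃
    inner₁   : ∃ λ x → Inner u v P₁ x
    inner₂   : ∃ λ x → Inner u v P₂ x
    inner₃   : ∃ λ x → Inner u v P₃ x
    disj₁₂   : ∀ x → Inner u v P₁ x → Inner u v P₂ x → ⊥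
    disj₁₃   : ∀ x → Inner u v P₁ x → Inner u v P₃ x → ⊥
    disj₂₃   : ∀ x → Inner u v P₂ x → Inner u v P₃ x → ⊥
    spanning : ∀ x → x ∈ P₁ ⊎ x ∈ P₂ ⊎ x ∈ P₃

MiddlePath : ∀ {n} → Graph n → Fin n → Fin n →
             List (List (Fin n)) → List (Fin n) → Set
MiddlePath G u v 𝒫 P =
  P ∈ 𝒫 × (∀ P' → P' ∈ 𝒫 → P' ≢ P →
           ∃₂ λ x y → Inner u v P x × Inner u v P' y × Edge G x y)

{-# OPTIONS --safe #-}
module Submission where

-- Say u₁ lies inside P₁ (the case P₃ is symmetric) and let Mᵢ be the interior of Pᵢ. Cut M₂
-- into X ++ Y with one neighbour of u₁ in X and the other in Y. As P₂ is a middle path, an edge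
-- wz joins some w ∈ M₂ to some z ∈ M₃. If w ∈ X, then M₁, M₃ ∪ {v}, X and Y are disjoint,
-- connected and pairwise joined by edges (M₁–X and M₁–Y through u₁, X–Y along P₂, X–M₃ through
-- wz, and the last edges of P₁ and P₂ into v), so they are the branch sets of a K₄ minor that
-- avoids u, and u serves as the K₁. If w ∈ Y the same works with M₃ ∪ {u}, and v is the K₁.

open import Defs
open import Data.Nat using (ℕ)
open import Data.Fin using (Fin; zero; suc; _≟_)
open import Data.Fin.Properties using (any?; punchInᵢ≢i)
open import Data.List using (List; []; _∷_; _++_; _∷ʳ_; [_]; last; lookup; initLast; _∷ʳ′_)
open import Data.List.Properties using (++-assoc)
open import Data.List.Membership.Propositional using (_∈_; _∉_)
open import Data.List.Membership.Propositional.Properties using (∈-lookup; ∈-++⁺ˡ; ∈-++⁺ʳ; ∈-++⁻)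
open import Data.List.Relation.Binary.Subset.Propositional using (_⊆_)
open import Data.List.Relation.Binary.Disjoint.Propositional using (Disjoint)
open import Data.List.Relation.Binary.Disjoint.Propositional.Properties using () renaming (sym to Disjoint-sym)
open import Data.List.Relation.Unary.All as All using (All; []; _∷_)
open import Data.List.Relation.Unary.AllPairs using (AllPairs; []; _∷_) renaming (tail to AllPairs-tail)
open import Data.List.Relation.Unary.Any as Any using (here; there)
open import Data.List.Relation.Unary.Unique.Propositional using (Unique)
open import Data.List.Relation.Unary.Unique.Propositional.Properties using (Unique[x∷xs]⇒x∉xs)
open import Data.Maybe using (Maybe; just; nothing)
open import Data.Maybe.Properties using (just-injective)
open import Data.Product using (∃; ∃₂; _×_; _,_; proj₁; proj₂; map₂)
open import Data.Sum using (_⊎_; inj₁; inj₂) renaming ([_,_] to either)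
open import Data.Unit using (tt)
open import Data.Empty using (⊥; ⊥-elim)
open import Function using (_∘_; id)
open import Level using (Level)
open import Relation.Binary.Core using (Rel)
open import Relation.Binary.Definitions using (Symmetric)
open import Relation.Binary.Construct.Closure.ReflexiveTransitive using (Star; ε; _◅_; _◅◅_; map; reverse)
open import Relation.Binary.PropositionalEquality
  using (_≡_; _≢_; refl; cong; trans; subst) renaming (sym to ≡-sym)
open import Relation.Nullary using (¬_; yes; no)

private
  variable
    a ℓ : Level
    A : Set a
    x y : A
    xs ys zs : List A

allPairs-lookup : {R : Rel A ℓ} → Symmetric R → AllPairs R xs →
                  ∀ {i j} → i ≢ j → R (lookup xs i) (lookup xs j)
allPairs-lookup sym (_ ∷ _)   {zero}  {zero}  i≢j = ⊥-elim (i≢j refl)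
allPairs-lookup sym (rx ∷ _)  {zero}  {suc j} _   = All.lookup rx (∈-lookup j)
allPairs-lookup sym (rx ∷ _)  {suc i} {zero}  _   = sym (All.lookup rx (∈-lookup i))
allPairs-lookup sym (_ ∷ rxs) {suc i} {suc j} i≢j = allPairs-lookup sym rxs (i≢j ∘ cong suc)

unique-++⇒disjoint : ∀ (xs : List A) → Unique (xs ++ ys) → Disjoint xs ys
unique-++⇒disjoint (_ ∷ xs) (x≢ ∷ _)  (here refl , y∈) = All.lookup x≢ (∈-++⁺ʳ xs y∈) refl
unique-++⇒disjoint (_ ∷ xs) (_ ∷ !xs) (there x∈ , y∈) = unique-++⇒disjoint xs !xs (x∈ , y∈)

disjoint-⊆ : {xs′ ys′ : List A} → xs ⊆ xs′ → ys ⊆ ys′ → Disjoint xs′ ys′ → Disjoint xs ys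
disjoint-⊆ xs⊆ ys⊆ xs′#ys′ (z∈xs , z∈ys) = xs′#ys′ (xs⊆ z∈xs , ys⊆ z∈ys)

disjoint-∷⁺ : x ∉ ys → Disjoint xs ys → Disjoint (x ∷ xs) ys
disjoint-∷⁺ x∉ys _     (here refl , x∈ys) = x∉ys x∈ys
disjoint-∷⁺ _    xs#ys (there z∈xs , z∈ys) = xs#ys (z∈xs , z∈ys)

disjoint-∷ʳ⁺ : ∀ (xs : List A) → x ∉ ys → Disjoint xs ys → Disjoint (xs ∷ʳ x) ys
disjoint-∷ʳ⁺ xs x∉ys xs#ys (z∈ , z∈ys) with ∈-++⁻ xs z∈
... | inj₁ z∈xs        = xs#ys (z∈xs , z∈ys)
... | inj₂ (here refl) = x∉ys z∈ys

split-between : x ≢ y → x ∈ zs → y ∈ zs →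
                ∃₂ λ xs ys → zs ≡ xs ++ ys × (x ∈ xs × y ∈ ys ⊎ y ∈ xs × x ∈ ys)
split-between x≢y (here refl) (here refl) = ⊥-elim (x≢y refl)
split-between {zs = z ∷ zs} _ (here refl) (there y∈) = [ z ] , zs , refl , inj₁ (here refl , y∈)
split-between {zs = z ∷ zs} _ (there x∈) (here refl) = [ z ] , zs , refl , inj₂ (here refl , x∈)
split-between {zs = z ∷ _} x≢y (there x∈) (there y∈) with split-between x≢y x∈ y∈
... | xs , ys , refl , inj₁ (x∈xs , y∈ys) = z ∷ xs , ys , refl , inj₁ (there x∈xs , y∈ys)
... | xs , ys , refl , inj₂ (y∈xs , x∈ys) = z ∷ xs , ys , refl , inj₂ (there y∈xs , x∈ys)

last-∷ʳ : ∀ (xs : List A) x → last (xs ∷ʳ x) ≡ just x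
last-∷ʳ []           _ = refl
last-∷ʳ (_ ∷ [])     _ = refl
last-∷ʳ (_ ∷ y ∷ xs) x = last-∷ʳ (y ∷ xs) x

start∉interior : {u v : A} {M : List A} → Unique (u ∷ M ∷ʳ v) → u ∉ M
start∉interior !P = Unique[x∷xs]⇒x∉xs !P ∘ ∈-++⁺ˡ

end∉interior : {u v : A} (M : List A) → Unique (u ∷ M ∷ʳ v) → v ∉ M
end∉interior M (_ ∷ !M) v∈M = unique-++⇒disjoint M !M (v∈M , here refl)

module _ {n : ℕ} where

  Inner⇒∈interior : {u v x : Fin n} {M : List (Fin n)} → Inner u v (u ∷ M ∷ʳ v) x → x ∈ M
  Inner⇒∈interior (here refl , x≢u , _) = ⊥-elim (x≢u refl)
  Inner⇒∈interior {M = M} (there x∈ , _ , x≢v) with ∈-++⁻ M x∈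
  ... | inj₁ x∈M        = x∈M
  ... | inj₂ (here refl) = ⊥-elim (x≢v refl)

  ∈interior⇒Inner : {u v x : Fin n} {M : List (Fin n)} →
                    Unique (u ∷ M ∷ʳ v) → x ∈ M → Inner u v (u ∷ M ∷ʳ v) x
  ∈interior⇒Inner {M = M} !P x∈M =
    there (∈-++⁺ˡ x∈M) ,
    (λ x≡u → start∉interior !P (subst (_∈ M) x≡u x∈M)) ,
    (λ x≡v → end∉interior M !P (subst (_∈ M) x≡v x∈M))

  interiors-disjoint : {u v : Fin n} {M N : List (Fin n)} →
                       Unique (u ∷ M ∷ʳ v) → Unique (u ∷ N ∷ʳ v) →
                       (∀ x → Inner u v (u ∷ M ∷ʳ v) x → Inner u v (u ∷ N ∷ʳ v) x → ⊥) →
                       Disjoint M N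
  interiors-disjoint !P !Q inner-disjoint (x∈M , x∈N) =
    inner-disjoint _ (∈interior⇒Inner !P x∈M) (∈interior⇒Inner !Q x∈N)

  inner-disjoint⇒≢ : {u v : Fin n} {P Q : List (Fin n)} → ∃ (Inner u v P) →
                     (∀ x → Inner u v P x → Inner u v Q x → ⊥) → P ≢ Q
  inner-disjoint⇒≢ (x , x-inner) inner-disjoint refl = inner-disjoint x x-inner x-inner

  path-interior : {G : Graph n} {u v : Fin n} {P : List (Fin n)} →
                  u ≢ v → IsPath G u v P → ∃ λ M → P ≡ u ∷ M ∷ʳ v
  path-interior {P = u ∷ rest} u≢v ((_ , refl , last≡v) , _) with initLast rest
  ... | []      = ⊥-elim (u≢v (just-injective last≡v))
  ... | M ∷ʳ′ y =
    M , cong (λ z → u ∷ M ∷ʳ z) (just-injective (trans (≡-sym (last-∷ʳ (u ∷ M) y)) last≡v))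

K₁∪K₄-edge⇒≢ : {i j : Fin 4} → Edge K₁∪K₄ (suc i) (suc j) → i ≢ j
K₁∪K₄-edge⇒≢ {i} e refl with i ≟ i
K₁∪K₄-edge⇒≢ () refl | yes _
... | no i≢i = i≢i refl

module _ {n : ℕ} (G : Graph n) where

  Edge-sym : Symmetric (Edge G)
  Edge-sym {x} {y} = trans (Graph.sym G y x)

  EdgeWithin : (Fin n → Set) → Rel (Fin n) _
  EdgeWithin P x y = P x × P y × Edge G x y

  star⇒walk : ∀ {P x y} → P x → Star (EdgeWithin P) x y → ∃ λ W → IsWalk G x y W × All P W
  star⇒walk {x = x} px ε = [ x ] , (tt , refl , refl) , px ∷ []
  star⇒walk {x = x} px ((_ , py , e) ◅ r) with star⇒walk py r
  ... | y ∷ W , (c , refl , last≡) , ps = x ∷ y ∷ W , ((e , c) , refl , last≡) , px ∷ ps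

  consecutive⇒star : ∀ {xs x y} → ConsecutiveAdj G xs → x ∈ xs → y ∈ xs →
                     Star (EdgeWithin (_∈ xs)) x y
  consecutive⇒star {_ ∷ _} c x∈ y∈ = reverse turn (from-head c x∈) ◅◅ from-head c y∈
    where
    turn : ∀ {P x y} → EdgeWithin P x y → EdgeWithin P y x
    turn (px , py , e) = py , px , Edge-sym e
    from-head : ∀ {z zs y} → ConsecutiveAdj G (z ∷ zs) → y ∈ z ∷ zs → Star (EdgeWithin (_∈ z ∷ zs)) z y
    from-head c (here refl) = ε
    from-head {zs = _ ∷ _} (e , c) (there y∈) =
      (here refl , there (here refl) , e) ◅ map (λ (p , q , e) → there p , there q , e) (from-head c y∈)

  consecutive-tail : ∀ {x xs} → ConsecutiveAdj G (x ∷ xs) → ConsecutiveAdj G xs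
  consecutive-tail {xs = []}    _       = tt
  consecutive-tail {xs = _ ∷ _} (_ , c) = c

  consecutive-++⁻ˡ : ∀ xs {ys} → ConsecutiveAdj G (xs ++ ys) → ConsecutiveAdj G xs
  consecutive-++⁻ˡ []           _       = tt
  consecutive-++⁻ˡ (_ ∷ [])     _       = tt
  consecutive-++⁻ˡ (_ ∷ x ∷ xs) (e , c) = e , consecutive-++⁻ˡ (x ∷ xs) c

  consecutive-++⁻ʳ : ∀ xs {ys} → ConsecutiveAdj G (xs ++ ys) → ConsecutiveAdj G ys
  consecutive-++⁻ʳ []       c = c
  consecutive-++⁻ʳ (_ ∷ xs) c = consecutive-++⁻ʳ xs (consecutive-tail c)

  Joined : Rel (List (Fin n)) _
  Joined A B = ∃₂ λ a b → a ∈ A × b ∈ B × Edge G a b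

  Joined-sym : Symmetric Joined
  Joined-sym (a , b , a∈ , b∈ , e) = b , a , b∈ , a∈ , Edge-sym e

  joined-⊆ : ∀ {xs xs′ ys ys′} → xs ⊆ xs′ → ys ⊆ ys′ → Joined xs ys → Joined xs′ ys′
  joined-⊆ xs⊆ ys⊆ (a , b , a∈ , b∈ , e) = a , b , xs⊆ a∈ , ys⊆ b∈ , e

  joined-++⁻ˡ : ∀ xs {ys zs} → Joined (xs ++ ys) zs → Joined xs zs ⊎ Joined ys zs
  joined-++⁻ˡ xs (a , b , a∈ , b∈ , e) with ∈-++⁻ xs a∈
  ... | inj₁ a∈xs = inj₁ (a , b , a∈xs , b∈ , e)
  ... | inj₂ a∈ys = inj₂ (a , b , a∈ys , b∈ , e)

  consecutive-++⇒joined : ∀ xs {ys x y} → ConsecutiveAdj G (xs ++ ys) → x ∈ xs → y ∈ ys → Joined xs ys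
  consecutive-++⇒joined (x ∷ [])     {y ∷ _} (e , _) _ _ = x , y , here refl , here refl , e
  consecutive-++⇒joined (_ ∷ x ∷ xs) (_ , c) _ y∈
    with consecutive-++⇒joined (x ∷ xs) c (here refl) y∈
  ... | a , b , a∈ , b∈ , e = a , b , there a∈ , b∈ , e

  Adjacent : Rel (List (Fin n)) _
  Adjacent A B = Disjoint A B × Joined A B

  Adjacent-sym : Symmetric Adjacent
  Adjacent-sym (A#B , A~B) = Disjoint-sym A#B , Joined-sym A~B

  private
    module K₁∪K₄Model (x : Fin n) (A B C D : List (Fin n))
        (connected : All (ConsecutiveAdj G) (A ∷ B ∷ C ∷ D ∷ []))
        (avoid : All (x ∉_) (A ∷ B ∷ C ∷ D ∷ []))
        (adjacent : AllPairs Adjacent (A ∷ B ∷ C ∷ D ∷ [])) where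

      Bs : Fin 4 → List (Fin n)
      Bs = lookup (A ∷ B ∷ C ∷ D ∷ [])

      Bs-adjacent : ∀ {i j} → i ≢ j → Adjacent (Bs i) (Bs j)
      Bs-adjacent = allPairs-lookup Adjacent-sym adjacent

      locate : Fin n → Maybe (Fin 4)
      locate y with any? (λ i → Any.any? (y ≟_) (Bs i))
      ... | yes (i , _) = just i
      ... | no _        = nothing

      locate-sound : ∀ {y i} → locate y ≡ just i → y ∈ Bs i
      locate-sound {y} _ with any? (λ i → Any.any? (y ≟_) (Bs i))
      locate-sound refl | yes (_ , y∈) = y∈

      locate-complete : ∀ {y i} → y ∈ Bs i → locate y ≡ just i
      locate-complete {y} {i} y∈ with any? (λ i → Any.any? (y ≟_) (Bs i))
      ... | no ∄ = ⊥-elim (∄ (i , y∈))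
      ... | yes (j , y∈ⱼ) with j ≟ i
      ...   | yes refl = refl
      ...   | no j≢i   = ⊥-elim (proj₁ (Bs-adjacent j≢i) (y∈ⱼ , y∈))

      branch : Fin n → Maybe (Fin 5)
      branch y with y ≟ x | locate y
      ... | yes _ | _       = just zero
      ... | no _  | just i  = just (suc i)
      ... | no _  | nothing = nothing

      branch-x : branch x ≡ just zero
      branch-x with x ≟ x
      ... | yes _  = refl
      ... | no x≢x = ⊥-elim (x≢x refl)

      branch-zero : ∀ {y} → branch y ≡ just zero → y ≡ x
      branch-zero {y} e with y ≟ x | locate y
      ... | yes y≡x | _ = y≡x
      branch-zero () | no _ | just _
      branch-zero () | no _ | nothing

      branch-suc : ∀ {y i} → branch y ≡ just (suc i) → y ∈ Bs i
      branch-suc {y} e with y ≟ x | locate y | locate-sound {y}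
      branch-suc refl | no _ | just _ | sound = sound refl

      branch-∈ : ∀ {y i} → y ∈ Bs i → branch y ≡ just (suc i)
      branch-∈ {y} {i} y∈ with y ≟ x | locate y | locate-complete y∈
      ... | yes refl | _ | _    = ⊥-elim (All.lookup avoid (∈-lookup i) y∈)
      ... | no _     | _ | refl = refl

      model : HasMinor K₁∪K₄ G
      model = record { branch = branch ; nonempty = nonempty ; connected = walks ; edges = edges }
        where
        nonempty : ∀ h → ∃ λ y → branch y ≡ just h
        nonempty zero    = x , branch-x
        nonempty (suc i) with Bs-adjacent (punchInᵢ≢i i zero ∘ ≡-sym)
        ... | _ , (y , _ , y∈ , _) = y , branch-∈ y∈

        walks : ∀ h y z → branch y ≡ just h → branch z ≡ just h →
                ∃ λ W → IsWalk G y z W × All (λ w → branch w ≡ just h) W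
        walks zero y z ey ez with branch-zero ey | branch-zero ez
        ... | refl | refl = star⇒walk ey ε
        walks (suc i) y z ey ez =
          map₂ (map₂ (All.map branch-∈))
            (star⇒walk (branch-suc ey)
              (consecutive⇒star (All.lookup connected (∈-lookup i)) (branch-suc ey) (branch-suc ez)))

        edges : ∀ h k → Edge K₁∪K₄ h k →
                ∃₂ λ y z → branch y ≡ just h × branch z ≡ just k × Edge G y z
        edges (suc i) (suc j) e with proj₂ (Bs-adjacent (K₁∪K₄-edge⇒≢ e))
        ... | y , z , y∈ , z∈ , yz = y , z , branch-∈ y∈ , branch-∈ z∈ , yz

  K₁∪K₄-minor : ∀ x {A B C D} →
                All (ConsecutiveAdj G) (A ∷ B ∷ C ∷ D ∷ []) → All (x ∉_) (A ∷ B ∷ C ∷ D ∷ []) →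
                AllPairs Adjacent (A ∷ B ∷ C ∷ D ∷ []) → HasMinor K₁∪K₄ G
  K₁∪K₄-minor x = K₁∪K₄Model.model x _ _ _ _

  record Theta (u v : Fin n) (M₁ M₂ M₃ : List (Fin n)) : Set where
    field
      u≢v        : u ≢ v
      path₁      : IsPath G u v (u ∷ M₁ ∷ʳ v)
      path₂      : IsPath G u v (u ∷ M₂ ∷ʳ v)
      path₃      : IsPath G u v (u ∷ M₃ ∷ʳ v)
      disjoint₁₂ : Disjoint M₁ M₂
      disjoint₁₃ : Disjoint M₁ M₃
      disjoint₂₃ : Disjoint M₂ M₃

  Theta-swap₁₃ : ∀ {u v M₁ M₂ M₃} → Theta u v M₁ M₂ M₃ → Theta u v M₃ M₂ M₁
  Theta-swap₁₃ θ = record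
    { u≢v = u≢v ; path₁ = path₃ ; path₂ = path₂ ; path₃ = path₁
    ; disjoint₁₂ = Disjoint-sym disjoint₂₃
    ; disjoint₁₃ = Disjoint-sym disjoint₁₃
    ; disjoint₂₃ = Disjoint-sym disjoint₁₂ }
    where open Theta θ

  subdivision⇒theta : ∀ {u v M₁ M₂ M₃} →
                      SpanningK23Subdivision G u v (u ∷ M₁ ∷ʳ v) (u ∷ M₂ ∷ʳ v) (u ∷ M₃ ∷ʳ v) →
                      Theta u v M₁ M₂ M₃
  subdivision⇒theta S = record
    { u≢v = u≢v ; path₁ = path₁ ; path₂ = path₂ ; path₃ = path₃
    ; disjoint₁₂ = interiors-disjoint (proj₂ path₁) (proj₂ path₂) disj₁₂
    ; disjoint₁₃ = interiors-disjoint (proj₂ path₁) (proj₂ path₃) disj₁₃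
    ; disjoint₂₃ = interiors-disjoint (proj₂ path₂) (proj₂ path₃) disj₂₃ }
    where open SpanningK23Subdivision S

  private
    module TwoChords {u v : Fin n} {M₁ X Y M₃ : List (Fin n)} (θ : Theta u v M₁ (X ++ Y) M₃)
                     {a p q : Fin n} (a∈M₁ : a ∈ M₁) (p∈X : p ∈ X) (q∈Y : q ∈ Y)
                     (ap : Edge G a p) (aq : Edge G a q) where
      open Theta θ

      c₁ : ConsecutiveAdj G (u ∷ M₁ ∷ʳ v)
      c₁ = proj₁ (proj₁ path₁)

      c₂ : ConsecutiveAdj G (u ∷ (X ++ Y) ∷ʳ v)
      c₂ = proj₁ (proj₁ path₂)

      c₃ : ConsecutiveAdj G (u ∷ M₃ ∷ʳ v)
      c₃ = proj₁ (proj₁ path₃)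

      XYv-connected : ConsecutiveAdj G (X ++ Y ∷ʳ v)
      XYv-connected = subst (ConsecutiveAdj G) (++-assoc X Y [ v ]) (consecutive-tail c₂)

      XYv-unique : Unique (X ++ Y ∷ʳ v)
      XYv-unique = subst Unique (++-assoc X Y [ v ]) (AllPairs-tail (proj₂ path₂))

      M₁-connected : ConsecutiveAdj G M₁
      M₁-connected = consecutive-++⁻ˡ M₁ (consecutive-tail c₁)

      X-connected : ConsecutiveAdj G X
      X-connected = consecutive-++⁻ˡ X XYv-connected

      Yv-connected : ConsecutiveAdj G (Y ∷ʳ v)
      Yv-connected = consecutive-++⁻ʳ X XYv-connected

      Y-connected : ConsecutiveAdj G Y
      Y-connected = consecutive-++⁻ˡ Y Yv-connected

      u∉X : u ∉ X
      u∉X = start∉interior (proj₂ path₂) ∘ ∈-++⁺ˡ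

      u∉Y : u ∉ Y
      u∉Y = start∉interior (proj₂ path₂) ∘ ∈-++⁺ʳ X

      v∉X : v ∉ X
      v∉X = end∉interior (X ++ Y) (proj₂ path₂) ∘ ∈-++⁺ˡ

      v∉Y : v ∉ Y
      v∉Y = end∉interior (X ++ Y) (proj₂ path₂) ∘ ∈-++⁺ʳ X

      M₃#M₁ : Disjoint M₃ M₁
      M₃#M₁ = Disjoint-sym disjoint₁₃

      M₃#X : Disjoint M₃ X
      M₃#X = disjoint-⊆ id ∈-++⁺ˡ (Disjoint-sym disjoint₂₃)

      M₃#Y : Disjoint M₃ Y
      M₃#Y = disjoint-⊆ id (∈-++⁺ʳ X) (Disjoint-sym disjoint₂₃)

      M₁⋈X : Adjacent M₁ X
      M₁⋈X = disjoint-⊆ id ∈-++⁺ˡ disjoint₁₂ , (a , p , a∈M₁ , p∈X , ap)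

      M₁⋈Y : Adjacent M₁ Y
      M₁⋈Y = disjoint-⊆ id (∈-++⁺ʳ X) disjoint₁₂ , (a , q , a∈M₁ , q∈Y , aq)

      X⋈Y : Adjacent X Y
      X⋈Y = disjoint-⊆ id ∈-++⁺ˡ (unique-++⇒disjoint X XYv-unique)
          , consecutive-++⇒joined X (consecutive-++⁻ˡ (X ++ Y) (consecutive-tail c₂)) p∈X q∈Y

      minor-via-X : Joined X M₃ → HasMinor K₁∪K₄ G
      minor-via-X X~M₃ =
        K₁∪K₄-minor u (M₁-connected ∷ consecutive-tail c₃ ∷ X-connected ∷ Y-connected ∷ [])
          (start∉interior (proj₂ path₁) ∷ Unique[x∷xs]⇒x∉xs (proj₂ path₃) ∷ u∉X ∷ u∉Y ∷ [])
          ((Adjacent-sym M₃v⋈M₁ ∷ M₁⋈X ∷ M₁⋈Y ∷ []) ∷ (M₃v⋈X ∷ M₃v⋈Y ∷ []) ∷ (X⋈Y ∷ []) ∷ [] ∷ [])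
        where
        M₃v⋈M₁ : Adjacent (M₃ ∷ʳ v) M₁
        M₃v⋈M₁ = disjoint-∷ʳ⁺ M₃ (end∉interior M₁ (proj₂ path₁)) M₃#M₁
               , joined-⊆ (∈-++⁺ʳ M₃) id
                   (Joined-sym (consecutive-++⇒joined M₁ (consecutive-tail c₁) a∈M₁ (here refl)))

        M₃v⋈X : Adjacent (M₃ ∷ʳ v) X
        M₃v⋈X = disjoint-∷ʳ⁺ M₃ v∉X M₃#X , joined-⊆ ∈-++⁺ˡ id (Joined-sym X~M₃)

        M₃v⋈Y : Adjacent (M₃ ∷ʳ v) Y
        M₃v⋈Y = disjoint-∷ʳ⁺ M₃ v∉Y M₃#Y
              , joined-⊆ (∈-++⁺ʳ M₃) id
                  (Joined-sym (consecutive-++⇒joined Y Yv-connected q∈Y (here refl)))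

      minor-via-Y : Joined Y M₃ → HasMinor K₁∪K₄ G
      minor-via-Y Y~M₃ =
        K₁∪K₄-minor v (M₁-connected ∷ consecutive-++⁻ˡ (u ∷ M₃) c₃ ∷ X-connected ∷ Y-connected ∷ [])
          (end∉interior M₁ (proj₂ path₁) ∷ v∉uM₃ ∷ v∉X ∷ v∉Y ∷ [])
          ((Adjacent-sym uM₃⋈M₁ ∷ M₁⋈X ∷ M₁⋈Y ∷ []) ∷ (uM₃⋈X ∷ uM₃⋈Y ∷ []) ∷ (X⋈Y ∷ []) ∷ [] ∷ [])
        where
        v∉uM₃ : v ∉ u ∷ M₃
        v∉uM₃ (here v≡u)  = u≢v (≡-sym v≡u)
        v∉uM₃ (there v∈) = end∉interior M₃ (proj₂ path₃) v∈

        uM₃⋈M₁ : Adjacent (u ∷ M₃) M₁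
        uM₃⋈M₁ = disjoint-∷⁺ (start∉interior (proj₂ path₁)) M₃#M₁
               , joined-⊆ ∈-++⁺ˡ id
                   (consecutive-++⇒joined [ u ] (consecutive-++⁻ˡ (u ∷ M₁) c₁) (here refl) a∈M₁)

        uX-connected : ConsecutiveAdj G (u ∷ X)
        uX-connected = consecutive-++⁻ˡ (u ∷ X) (consecutive-++⁻ˡ (u ∷ X ++ Y) c₂)

        uM₃⋈X : Adjacent (u ∷ M₃) X
        uM₃⋈X = disjoint-∷⁺ u∉X M₃#X
              , joined-⊆ ∈-++⁺ˡ id
                  (consecutive-++⇒joined [ u ] uX-connected (here refl) p∈X)

        uM₃⋈Y : Adjacent (u ∷ M₃) Y
        uM₃⋈Y = disjoint-∷⁺ u∉Y M₃#Y , joined-⊆ there id (Joined-sym Y~M₃)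

      minor : Joined X M₃ ⊎ Joined Y M₃ → HasMinor K₁∪K₄ G
      minor = either minor-via-X minor-via-Y

  two-chords-minor : ∀ {u v M₁ M₂ M₃ a p q} → Theta u v M₁ M₂ M₃ →
                     a ∈ M₁ → p ∈ M₂ → q ∈ M₂ → p ≢ q → Edge G a p → Edge G a q →
                     Joined M₂ M₃ → HasMinor K₁∪K₄ G
  two-chords-minor θ a∈ p∈ q∈ p≢q ap aq M₂~M₃ with split-between p≢q p∈ q∈
  ... | X , Y , refl , inj₁ (p∈X , q∈Y) = TwoChords.minor θ a∈ p∈X q∈Y ap aq (joined-++⁻ˡ X M₂~M₃)
  ... | X , Y , refl , inj₂ (q∈X , p∈Y) = TwoChords.minor θ a∈ q∈X p∈Y aq ap (joined-++⁻ˡ X M₂~M₃)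

  inner-edge⇒joined : ∀ {u v M N} →
                      (∃₂ λ x y → Inner u v (u ∷ M ∷ʳ v) x × Inner u v (u ∷ N ∷ʳ v) y × Edge G x y) →
                      Joined M N
  inner-edge⇒joined (x , y , x-inner , y-inner , e) =
    x , y , Inner⇒∈interior x-inner , Inner⇒∈interior y-inner , e

  subdivision-interiors : ∀ {u v P₁ P₂ P₃} → SpanningK23Subdivision G u v P₁ P₂ P₃ →
                          ∃ λ M₁ → ∃ λ M₂ → ∃ λ M₃ →
                            P₁ ≡ u ∷ M₁ ∷ʳ v × P₂ ≡ u ∷ M₂ ∷ʳ v × P₃ ≡ u ∷ M₃ ∷ʳ v
  subdivision-interiors S
    with path-interior u≢v path₁ | path-interior u≢v path₂ | path-interior u≢v path₃
    where open SpanningK23Subdivision S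
  ... | M₁ , P₁≡ | M₂ , P₂≡ | M₃ , P₃≡ = M₁ , M₂ , M₃ , P₁≡ , P₂≡ , P₃≡

lemma7 : ∀ {n : ℕ} (G : Graph n) → ¬ HasMinor K₁∪K₄ G →
         ∀ (u v : Fin n) (P₁ P₂ P₃ : List (Fin n)) →
         SpanningK23Subdivision G u v P₁ P₂ P₃ →
         MiddlePath G u v (P₁ ∷ P₂ ∷ P₃ ∷ []) P₂ →
         ¬ (∃ λ u₁ → ∃ λ v₁ → ∃ λ v₂ →
              (Inner u v P₁ u₁ ⊎ Inner u v P₃ u₁) ×
              Inner u v P₂ v₁ × Inner u v P₂ v₂ × v₁ ≢ v₂ ×
              Edge G u₁ v₁ × Edge G u₁ v₂)
lemma7 G no-minor u v P₁ P₂ P₃ S (_ , middle)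
       (u₁ , v₁ , v₂ , u₁-inner , v₁-inner , v₂-inner , v₁≢v₂ , e₁ , e₂)
  with subdivision-interiors G S
... | M₁ , M₂ , M₃ , refl , refl , refl = no-minor (either via-P₁ via-P₃ u₁-inner)
  where
  open SpanningK23Subdivision S

  chords : ∀ {M M′} → Theta G u v M M₂ M′ → u₁ ∈ M → Joined G M₂ M′ → HasMinor K₁∪K₄ G
  chords θ u₁∈ =
    two-chords-minor G θ u₁∈ (Inner⇒∈interior v₁-inner) (Inner⇒∈interior v₂-inner) v₁≢v₂ e₁ e₂

  via-P₁ : Inner u v P₁ u₁ → HasMinor K₁∪K₄ G
  via-P₁ u₁∈P₁ = chords (subdivision⇒theta G S) (Inner⇒∈interior u₁∈P₁)
    (inner-edge⇒joined G (middle P₃ (there (there (here refl)))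
                                 (inner-disjoint⇒≢ inner₃ λ x i₃ i₂ → disj₂₃ x i₂ i₃)))

  via-P₃ : Inner u v P₃ u₁ → HasMinor K₁∪K₄ G
  via-P₃ u₁∈P₃ = chords (Theta-swap₁₃ G (subdivision⇒theta G S)) (Inner⇒∈interior u₁∈P₃)
    (inner-edge⇒joined G (middle P₁ (here refl) (inner-disjoint⇒≢ inner₁ disj₁₂)))
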